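{- Let $\mathit{Sign}$ be a category endowed with an inclusion system and having pullbacks of semi-inclusive cospans. Let $p\mathit{Sign}$ be the structure whose objects are the objects of $\mathit{Sign}$ and whose arrows are the partial $\mathit{Sign}$-morphisms, with the composition and the order $\leq$ on hom-sets defined below, and with identities $[1_\Sigma]$. Then $p\mathit{Sign}$ is a $\frac{3}{2}$-category.
   Context: Composition of arrows is written diagrammatically: $f;g$ means first $f$, then $g$. An inclusion system for a category $\mathbf{C}$ is a pair $(\mathcal{I},\mathcal{E})$ of broad subcategories of $\mathbf{C}$ such that $\mathcal{I}$ is a partial order (its arrows are called abstract inclusions and an abstract inclusion $A\to B$ is written $A\subseteq B$) and every arrow $f$ of $\mathbf{C}$ factors uniquely as $f=e_f;i_f$ with $e_f\in\mathcal{E}$ and $i_f\in\mathcal{I}$ (arrows of $\mathcal{E}$ are called abstract surjections). A cospan $f_1\colon A_1\to A$, $f_2\colon A_2\to A$ is semi-inclusive when $f_1$ or $f_2$ is an abstract inclusion. In a category with an inclusion system and pullbacks of semi-inclusive cospans, for every $f\colon A\to B$ and every abstract inclusion $B'\subseteq B$ there is a unique pullback square of $f$ and $B'\subseteq B$ whose side towards $A$ is an abstract inclusion $A'\subseteq A$; call it the inclusive pullback, with other side $f'\colon A'\to B'$. A partial $\mathit{Sign}$-morphism $\varphi\colon\Sigma\rightharpoonup\Sigma'$ is a $\mathit{Sign}$-morphism $\varphi^0\colon \mathrm{dom}\,\varphi\to\Sigma'$ together with an abstract inclusion $\mathrm{dom}\,\varphi\subseteq\Sigma$. The composition of $\varphi\colon\Sigma\rightharpoonup\Sigma'$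 and $\varphi'\colon\Sigma'\rightharpoonup\Sigma''$ is defined as follows: take the inclusive pullback of $\varphi^0\colon\mathrm{dom}\,\varphi\to\Sigma'$ along $\mathrm{dom}\,\varphi'\subseteq\Sigma'$, with vertex $D\subseteq \mathrm{dom}\,\varphi$ and side $(\varphi^0)'\colon D\to\mathrm{dom}\,\varphi'$; then $\mathrm{dom}(\varphi;\varphi')=D$ (with $D\subseteq\mathrm{dom}\,\varphi\subseteq\Sigma$) and $(\varphi;\varphi')^0=(\varphi^0)';\varphi'^0$. For $\varphi,\theta\colon\Sigma\rightharpoonup\Sigma'$, $\varphi\leq\theta$ iff $\mathrm{dom}\,\varphi\subseteq\mathrm{dom}\,\theta$ and $\varphi^0=(\mathrm{dom}\,\varphi\subseteq\mathrm{dom}\,\theta);\theta^0$. For $\chi\colon\Sigma\to\Sigma'$ in $\mathit{Sign}$, $[\chi]$ denotes the partial morphism with $\mathrm{dom}[\chi]=\Sigma$ and $[\chi]^0=\chi$. A $\frac{3}{2}$-category is a category whose hom-sets are partially ordered and whose composition preserves these orders (in each argument). -}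

module Defs where

open import Level using (Level; _⊔_) renaming (suc to lsuc)
open import Relation.Binary.PropositionalEquality using (_≡_)
open import Relation.Binary.Structures using (IsPartialOrder)
open import Data.Product using (Σ; _×_; _,_)
open import Data.Sum using (_⊎_)

-- Categories (arrow equality is propositional equality).
-- Composition is written diagrammatically: f ； g  means first f, then g.

record Category (o ℓ : Level) : Set (lsuc (o ⊔ ℓ)) where
  infixr 9 _；_
  field
    Obj       : Set o
    Hom       : Obj → Obj → Set ℓ
    id        : ∀ {A} → Hom A A
    _；_       : ∀ {A B C} → Hom A B → Hom B C → Hom A C
    identityˡ : ∀ {A B} (f : Hom A B) → id ； f ≡ f
    identityʳ : ∀ {A B} (f : Hom A B) → f ； id ≡ f
    assoc     : ∀ {A B C D} (f : Hom A B) (g : Hom B C) (h : Hom C D) →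
                (f ； g) ； h ≡ f ； (g ； h)

module _ {o ℓ : Level} (C : Category o ℓ) where
  open Category C

  record BroadSubcategory (r : Level) : Set (o ⊔ ℓ ⊔ lsuc r) where
    field
      Arr     : ∀ {A B} → Hom A B → Set r
      Arr-prop : ∀ {A B} {f : Hom A B} (p q : Arr f) → p ≡ q
      Arr-id  : ∀ {A} → Arr (id {A})
      Arr-；   : ∀ {A B D} {f : Hom A B} {g : Hom B D} → Arr f → Arr g → Arr (f ； g)

  record Factorisation {r s : Level} (𝓘 : BroadSubcategory r) (𝓔 : BroadSubcategory s)
                       {A B : Obj} (f : Hom A B) : Set (o ⊔ ℓ ⊔ r ⊔ s) where
    field
      mid    : Obj
      e      : Hom A mid
      i      : Hom mid B
      e-surj : BroadSubcategory.Arr 𝓔 e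
      i-incl : BroadSubcategory.Arr 𝓘 i
      eq     : f ≡ e ； i

  record InclusionSystem (r s : Level) : Set (o ⊔ ℓ ⊔ lsuc (r ⊔ s)) where
    field
      𝓘 : BroadSubcategory r
      𝓔 : BroadSubcategory s
      𝓘-thin    : ∀ {A B} (i j : Hom A B) →
                  BroadSubcategory.Arr 𝓘 i → BroadSubcategory.Arr 𝓘 j → i ≡ j
      𝓘-antisym : ∀ {A B} (i : Hom A B) (j : Hom B A) →
                  BroadSubcategory.Arr 𝓘 i → BroadSubcategory.Arr 𝓘 j → A ≡ B
      factor        : ∀ {A B} (f : Hom A B) → Factorisation 𝓘 𝓔 f
      factor-unique : ∀ {A B} (f : Hom A B) (x y : Factorisation 𝓘 𝓔 f) →
        _≡_ {A = Σ Obj (λ M → Hom A M × Hom M B)}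
            (Factorisation.mid x , Factorisation.e x , Factorisation.i x)
            (Factorisation.mid y , Factorisation.e y , Factorisation.i y)

    Incl : ∀ {A B} → Hom A B → Set r
    Incl = BroadSubcategory.Arr 𝓘

    Surj : ∀ {A B} → Hom A B → Set s
    Surj = BroadSubcategory.Arr 𝓔

  record IsPullback {A₁ A₂ A P : Obj} (f₁ : Hom A₁ A) (f₂ : Hom A₂ A)
                    (p₁ : Hom P A₁) (p₂ : Hom P A₂) : Set (o ⊔ ℓ) where
    field
      commute   : p₁ ； f₁ ≡ p₂ ； f₂
      mediate   : ∀ {X} (q₁ : Hom X A₁) (q₂ : Hom X A₂) → q₁ ； f₁ ≡ q₂ ； f₂ →
                  Hom X P
      mediate-₁ : ∀ {X} (q₁ : Hom X A₁) (q₂ : Hom X A₂) (c : q₁ ； f₁ ≡ q₂ ； f₂) →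
                  mediate q₁ q₂ c ； p₁ ≡ q₁
      mediate-₂ : ∀ {X} (q₁ : Hom X A₁) (q₂ : Hom X A₂) (c : q₁ ； f₁ ≡ q₂ ； f₂) →
                  mediate q₁ q₂ c ； p₂ ≡ q₂
      unique    : ∀ {X} (q₁ : Hom X A₁) (q₂ : Hom X A₂) (c : q₁ ； f₁ ≡ q₂ ； f₂)
                  (m : Hom X P) → m ； p₁ ≡ q₁ → m ； p₂ ≡ q₂ → m ≡ mediate q₁ q₂ c

  record Pullback {A₁ A₂ A : Obj} (f₁ : Hom A₁ A) (f₂ : Hom A₂ A) : Set (o ⊔ ℓ) where
    field
      P    : Obj
      p₁   : Hom P A₁
      p₂   : Hom P A₂
      isPB : IsPullback f₁ f₂ p₁ p₂

  module _ {r s : Level} (IS : InclusionSystem r s) where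
    open InclusionSystem IS

    HasSemiInclusivePullbacks : Set (o ⊔ ℓ ⊔ r)
    HasSemiInclusivePullbacks = ∀ {A₁ A₂ A} (f₁ : Hom A₁ A) (f₂ : Hom A₂ A) →
      Incl f₁ ⊎ Incl f₂ → Pullback f₁ f₂

    record InclusivePullback {A B B'} (f : Hom A B) (i : Hom B' B) : Set (o ⊔ ℓ ⊔ r) where
      field
        A'     : Obj
        j      : Hom A' A
        j-incl : Incl j
        f'     : Hom A' B'
        isPB   : IsPullback f i j f'

    InclusivePullbackChoice : Set (o ⊔ ℓ ⊔ r)
    InclusivePullbackChoice = ∀ {A B B'} (f : Hom A B) (i : Hom B' B) → Incl i →
      InclusivePullback f i

    record PMor (Σ₁ Σ₂ : Obj) : Set (o ⊔ ℓ ⊔ r) where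
      constructor pmor
      field
        dom      : Obj
        incl     : Hom dom Σ₁
        incl-inc : Incl incl
        φ⁰       : Hom dom Σ₂

    open PMor

    [_] : ∀ {Σ₁ Σ₂} → Hom Σ₁ Σ₂ → PMor Σ₁ Σ₂
    [ χ ] = pmor _ id (BroadSubcategory.Arr-id 𝓘) χ

    pcomp : InclusivePullbackChoice → ∀ {Σ₁ Σ₂ Σ₃} → PMor Σ₁ Σ₂ → PMor Σ₂ Σ₃ → PMor Σ₁ Σ₃
    pcomp ipb φ ψ =
      pmor (InclusivePullback.A' q)
           (InclusivePullback.j q ； incl φ)
           (BroadSubcategory.Arr-； 𝓘 (InclusivePullback.j-incl q) (incl-inc φ))
           (InclusivePullback.f' q ； φ⁰ ψ)
      where q = ipb (φ⁰ φ) (incl ψ) (incl-inc ψ)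

    _≤ₚ_ : ∀ {Σ₁ Σ₂} → PMor Σ₁ Σ₂ → PMor Σ₁ Σ₂ → Set (ℓ ⊔ r)
    φ ≤ₚ θ = Σ (Hom (dom φ) (dom θ)) λ k → Incl k × (φ⁰ φ ≡ k ； φ⁰ θ)

record Is3/2Category {o ℓ r : Level} (Obj : Set o) (Hom : Obj → Obj → Set ℓ)
       (_≤_ : ∀ {A B} → Hom A B → Hom A B → Set r)
       (id : ∀ {A} → Hom A A)
       (_；_ : ∀ {A B C} → Hom A B → Hom B C → Hom A C) : Set (o ⊔ ℓ ⊔ r) where
  field
    identityˡ : ∀ {A B} (f : Hom A B) → id ； f ≡ f
    identityʳ : ∀ {A B} (f : Hom A B) → f ； id ≡ f
    assoc     : ∀ {A B C D} (f : Hom A B) (g : Hom B C) (h : Hom C D) →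
                (f ； g) ； h ≡ f ； (g ； h)
    isPartialOrder : ∀ {A B} → IsPartialOrder _≡_ (_≤_ {A} {B})
    ；-monoˡ  : ∀ {A B C} {f f' : Hom A B} (g : Hom B C) → f ≤ f' → (f ； g) ≤ (f' ； g)
    ；-monoʳ  : ∀ {A B C} (f : Hom A B) {g g' : Hom B C} → g ≤ g' → (f ； g) ≤ (f ； g')

-- Abstract inclusions are monic, and an arrow mediating between two squares
-- whose sides towards A are inclusions is itself an inclusion; with
-- antisymmetry of 𝓘 this makes inclusive pullbacks unique on the nose.  So a
-- composite of partial morphisms can be computed from any inclusive pullback,
-- and the category laws become classical facts: pullbacks along identities are
-- trivial, and pasting pullbacks gives a pullback.  Monotonicity holds because
-- mediating arrows are inclusions.  Inclusive pullbacks exist: factor the side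
-- towards A of a pullback as e ； j; the diagonal fill-in of the inclusion
-- system provides the other side, and e is split by the mediating arrow.
module Submission where

open import Defs
open import Level using (Level; _⊔_)
open import Data.Product using (_×_; Σ-syntax; _,_; proj₁; proj₂)
open import Data.Sum using (inj₂)
open import Relation.Binary.PropositionalEquality hiding ([_])
open import Relation.Binary.Structures using (IsPartialOrder)

module PullbackProperties {o ℓ : Level} (C : Category o ℓ) where
  open Category C
  open IsPullback
  open ≡-Reasoning

  private variable
    A A₁ A₂ B B' D P M X : Obj

  extendˡ : {a : Hom A B} {b : Hom B D} {c : Hom A M} {d : Hom M D}
            (x : Hom X A) → a ； b ≡ c ； d → (x ； a) ； b ≡ (x ； c) ； d
  extendˡ x abcd = trans (assoc _ _ _) (trans (cong (x ；_) abcd) (sym (assoc _ _ _)))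

  pullback-jointly-monic : {f₁ : Hom A₁ A} {f₂ : Hom A₂ A} {p₁ : Hom P A₁} {p₂ : Hom P A₂} →
    IsPullback C f₁ f₂ p₁ p₂ → (m n : Hom X P) →
    m ； p₁ ≡ n ； p₁ → m ； p₂ ≡ n ； p₂ → m ≡ n
  pullback-jointly-monic pb m n mp₁ mp₂ =
    trans (unique pb _ _ c m mp₁ mp₂) (sym (unique pb _ _ c n refl refl))
    where c = extendˡ n (commute pb)

  pullback-of-id : (g : Hom A₂ A) → IsPullback C id g g id
  pullback-of-id g = record
    { commute   = trans (identityʳ g) (sym (identityˡ g))
    ; mediate   = λ _ q₂ _ → q₂
    ; mediate-₁ = λ q₁ q₂ c → trans (sym c) (identityʳ q₁)
    ; mediate-₂ = λ _ q₂ _ → identityʳ q₂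
    ; unique    = λ _ _ _ m _ m₂ → trans (sym (identityʳ m)) m₂
    }

  pullback-along-id : (f : Hom A₁ A) → IsPullback C f id id f
  pullback-along-id f = record
    { commute   = trans (identityˡ f) (sym (identityʳ f))
    ; mediate   = λ q₁ _ _ → q₁
    ; mediate-₁ = λ q₁ _ _ → identityʳ q₁
    ; mediate-₂ = λ _ q₂ c → trans c (identityʳ q₂)
    ; unique    = λ _ _ _ m m₁ _ → trans (sym (identityʳ m)) m₁
    }

  pullback-retract : {f₁ : Hom A₁ A} {f₂ : Hom A₂ A} {p₁ : Hom P A₁} {p₂ : Hom P A₂}
    {j : Hom M A₁} {g : Hom M A₂} (e : Hom P M) (m : Hom M P) →
    IsPullback C f₁ f₂ p₁ p₂ → e ； j ≡ p₁ → e ； g ≡ p₂ → m ； e ≡ id →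
    IsPullback C f₁ f₂ j g
  pullback-retract {f₁ = f₁} {f₂} {p₁} {p₂} {j} {g} e m pb ej eg me = record
    { commute   = begin
        j ； f₁           ≡⟨ cong (_； f₁) (through-m ej) ⟩
        (m ； p₁) ； f₁   ≡⟨ assoc _ _ _ ⟩
        m ； (p₁ ； f₁)   ≡⟨ cong (m ；_) (commute pb) ⟩
        m ； (p₂ ； f₂)   ≡⟨ sym (assoc _ _ _) ⟩
        (m ； p₂) ； f₂   ≡⟨ cong (_； f₂) (sym (through-m eg)) ⟩
        g ； f₂           ∎
    ; mediate   = λ q₁ q₂ c → mediate pb q₁ q₂ c ； e
    ; mediate-₁ = λ q₁ q₂ c →
        trans (assoc _ _ _) (trans (cong (mediate pb q₁ q₂ c ；_) ej) (mediate-₁ pb q₁ q₂ c))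
    ; mediate-₂ = λ q₁ q₂ c →
        trans (assoc _ _ _) (trans (cong (mediate pb q₁ q₂ c ；_) eg) (mediate-₂ pb q₁ q₂ c))
    ; unique    = λ q₁ q₂ c n n₁ n₂ → begin
        n                  ≡⟨ sym (identityʳ n) ⟩
        n ； id            ≡⟨ cong (n ；_) (sym me) ⟩
        n ； (m ； e)      ≡⟨ sym (assoc _ _ _) ⟩
        (n ； m) ； e      ≡⟨ cong (_； e) (unique pb q₁ q₂ c (n ； m)
                               (trans (assoc _ _ _) (trans (cong (n ；_) (sym (through-m ej))) n₁))
                               (trans (assoc _ _ _) (trans (cong (n ；_) (sym (through-m eg))) n₂))) ⟩
        mediate pb q₁ q₂ c ； e ∎
    }
    where
      through-m : ∀ {Y} {k : Hom _ Y} {p : Hom _ Y} → e ； k ≡ p → k ≡ m ； p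
      through-m {k = k} ek = begin
        k              ≡⟨ sym (identityˡ k) ⟩
        id ； k        ≡⟨ cong (_； k) (sym me) ⟩
        (m ； e) ； k  ≡⟨ assoc _ _ _ ⟩
        m ； (e ； k)  ≡⟨ cong (m ；_) ek ⟩
        _              ∎

  pullback-cancelʳ : {f : Hom A₁ A} {b : Hom A B} {k : Hom M A} {g : Hom M B'}
    {i : Hom B' B} {j : Hom P A₁} {f₂ : Hom P B'} →
    IsPullback C b i k g → IsPullback C (f ； b) i j f₂ →
    Σ[ h ∈ Hom P M ] IsPullback C f k j h × h ； g ≡ f₂
  pullback-cancelʳ {f = f} {b} {k} {g} {i} {j} {f₂} right outer =
    h , isPB , mediate-₂ right (j ； f) f₂ c
    where
      c = trans (assoc _ _ _) (commute outer)
      h = mediate right (j ； f) f₂ c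
      isPB : IsPullback C f k j h
      isPB = record
        { commute   = sym (mediate-₁ right (j ； f) f₂ c)
        ; mediate   = λ q₁ q₂ c' → mediate outer q₁ (q₂ ； g) (rectangle q₁ q₂ c')
        ; mediate-₁ = λ q₁ q₂ c' → mediate-₁ outer q₁ (q₂ ； g) (rectangle q₁ q₂ c')
        ; mediate-₂ = λ q₁ q₂ c' →
            let w = mediate outer q₁ (q₂ ； g) (rectangle q₁ q₂ c') in
            pullback-jointly-monic right (w ； h) q₂
              (begin
                (w ； h) ； k  ≡⟨ assoc _ _ _ ⟩
                w ； (h ； k)  ≡⟨ cong (w ；_) (mediate-₁ right (j ； f) f₂ c) ⟩
                w ； (j ； f)  ≡⟨ sym (assoc _ _ _) ⟩
                (w ； j) ； f  ≡⟨ cong (_； f) (mediate-₁ outer q₁ (q₂ ； g) (rectangle q₁ q₂ c')) ⟩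
                q₁ ； f        ≡⟨ c' ⟩
                q₂ ； k        ∎)
              (trans (assoc _ _ _) (trans (cong (w ；_) (mediate-₂ right (j ； f) f₂ c))
                (mediate-₂ outer q₁ (q₂ ； g) (rectangle q₁ q₂ c'))))
        ; unique    = λ q₁ q₂ c' n n₁ n₂ →
            unique outer q₁ (q₂ ； g) (rectangle q₁ q₂ c') n n₁
              (trans (cong (n ；_) (sym (mediate-₂ right (j ； f) f₂ c)))
                (trans (sym (assoc _ _ _)) (cong (_； g) n₂)))
        }
        where
          rectangle : ∀ {Y} (q₁ : Hom Y _) (q₂ : Hom Y _) →
                      q₁ ； f ≡ q₂ ； k → q₁ ； (f ； b) ≡ (q₂ ； g) ； i
          rectangle q₁ q₂ c' = begin
            q₁ ； (f ； b)   ≡⟨ sym (assoc _ _ _) ⟩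
            (q₁ ； f) ； b   ≡⟨ trans (cong (_； b) c') (extendˡ q₂ (commute right)) ⟩
            (q₂ ； g) ； i   ∎

  pullback-paste : {a : Hom A₁ A} {i : Hom A₂ A} {j₁ : Hom D A₁} {f₁ : Hom D A₂}
    {k : Hom M A₂} {j₂ : Hom P D} {h : Hom P M} →
    IsPullback C a i j₁ f₁ → IsPullback C f₁ k j₂ h →
    IsPullback C a (k ； i) (j₂ ； j₁) h
  pullback-paste {a = a} {i} {j₁} {f₁} {k} {j₂} {h} right left = record
    { commute   = begin
        (j₂ ； j₁) ； a   ≡⟨ assoc _ _ _ ⟩
        j₂ ； (j₁ ； a)   ≡⟨ cong (j₂ ；_) (commute right) ⟩
        j₂ ； (f₁ ； i)   ≡⟨ sym (assoc _ _ _) ⟩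
        (j₂ ； f₁) ； i   ≡⟨ cong (_； i) (commute left) ⟩
        (h ； k) ； i     ≡⟨ assoc _ _ _ ⟩
        h ； (k ； i)     ∎
    ; mediate   = λ q₁ q₂ c → mediate left (u q₁ q₂ c) q₂ (mediate-₂ right q₁ (q₂ ； k) (c' c))
    ; mediate-₁ = λ q₁ q₂ c →
        trans (sym (assoc _ _ _))
          (trans (cong (_； j₁) (mediate-₁ left (u q₁ q₂ c) q₂ (mediate-₂ right q₁ (q₂ ； k) (c' c))))
            (mediate-₁ right q₁ (q₂ ； k) (c' c)))
    ; mediate-₂ = λ q₁ q₂ c → mediate-₂ left (u q₁ q₂ c) q₂ (mediate-₂ right q₁ (q₂ ； k) (c' c))
    ; unique    = λ q₁ q₂ c n n₁ n₂ →
        unique left (u q₁ q₂ c) q₂ (mediate-₂ right q₁ (q₂ ； k) (c' c)) n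
          (unique right q₁ (q₂ ； k) (c' c) (n ； j₂) (trans (assoc _ _ _) n₁)
            (trans (extendˡ n (commute left)) (cong (_； k) n₂)))
          n₂
    }
    where
      c' : ∀ {Y} {q₁ : Hom Y _} {q₂ : Hom Y _} → q₁ ； a ≡ q₂ ； (k ； i) → q₁ ； a ≡ (q₂ ； k) ； i
      c' c = trans c (sym (assoc _ _ _))
      u : ∀ {Y} (q₁ : Hom Y _) (q₂ : Hom Y _) → q₁ ； a ≡ q₂ ； (k ； i) → Hom Y _
      u q₁ q₂ c = mediate right q₁ (q₂ ； k) (c' c)

module InclusionSystemProperties {o ℓ r s : Level} {C : Category o ℓ}
                                 (IS : InclusionSystem C r s) where
  open Category C
  open InclusionSystem IS
  open BroadSubcategory 𝓘 using () renaming (Arr-id to Incl-id; Arr-； to Incl-；)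
  open Factorisation
  open IsPullback
  open PullbackProperties C
  open ≡-Reasoning

  private variable
    A A₁ A₂ B B' P X Y : Obj

  Span : Obj → Obj → Set (o ⊔ ℓ)
  Span A B = Σ[ X ∈ Obj ] Hom X A × Hom X B

  Factored : Obj → Obj → Set (o ⊔ ℓ)
  Factored A B = Σ[ M ∈ Obj ] Hom A M × Hom M B

  retarget : {f g : Hom A B} → Factorisation C 𝓘 𝓔 f → f ≡ g → Factorisation C 𝓘 𝓔 g
  retarget F f≡g = record { e = e F ; i = i F ; e-surj = e-surj F ; i-incl = i-incl F
                         ; eq = trans (sym f≡g) (eq F) }

  postcompose-Incl : {f : Hom A B} {j : Hom B B'} → Factorisation C 𝓘 𝓔 f → Incl j →
                     Factorisation C 𝓘 𝓔 (f ； j)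
  postcompose-Incl {j = j} F j∈ = record
    { e = e F ; e-surj = e-surj F ; i = i F ； j ; i-incl = Incl-； (i-incl F) j∈
    ; eq = trans (cong (_； j) (eq F)) (assoc _ _ _) }

  Incl-endo⇒id : {k : Hom A A} → Incl k → k ≡ id
  Incl-endo⇒id k∈ = 𝓘-thin _ id k∈ Incl-id

  incl-monic : {g h : Hom X A} {j : Hom A B} → Incl j → g ； j ≡ h ； j → g ≡ h
  incl-monic {g = g} {h} j∈ gj≡hj = begin
    g                    ≡⟨ eq (factor g) ⟩
    e (factor g) ； i (factor g)
      ≡⟨ same-composite (i-incl (factor g)) (i-incl (factor h))
           (factor-unique _ (postcompose-Incl (factor g) j∈)
                            (retarget (postcompose-Incl (factor h) j∈) (sym gj≡hj))) ⟩
    e (factor h) ； i (factor h) ≡⟨ sym (eq (factor h)) ⟩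
    h                    ∎
    where
      same-composite : ∀ {M N} {e₁ : Hom X M} {e₂ : Hom X N} {i₁ : Hom M A} {i₂ : Hom N A}
        {k₁ : Hom M B} {k₂ : Hom N B} → Incl i₁ → Incl i₂ →
        _≡_ {A = Factored _ _} (M , e₁ , k₁) (N , e₂ , k₂) →
        e₁ ； i₁ ≡ e₂ ； i₂
      same-composite {e₁ = e₁} i₁∈ i₂∈ refl = cong (e₁ ；_) (𝓘-thin _ _ i₁∈ i₂∈)

  Incl-cancelʳ : {m : Hom X A} {j : Hom A B} {k : Hom X B} →
                 Incl j → Incl k → m ； j ≡ k → Incl m
  Incl-cancelʳ {m = m} {j} {k} j∈ k∈ mj≡k =
    subst Incl (sym (eq (factor m)))
      (surjective-part-trivial (i-incl (factor m))
        (factor-unique k (retarget (postcompose-Incl (factor m) j∈) mj≡k) trivial))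
    where
      trivial : Factorisation C 𝓘 𝓔 k
      trivial = record { e = id ; i = k ; e-surj = BroadSubcategory.Arr-id 𝓔 ; i-incl = k∈
                       ; eq = sym (identityˡ k) }
      surjective-part-trivial : ∀ {M} {e₁ : Hom _ M} {i₁ : Hom M _} {k₁ : Hom M _} → Incl i₁ →
        _≡_ {A = Factored _ _} (M , e₁ , k₁) (_ , id , k) → Incl (e₁ ； i₁)
      surjective-part-trivial {i₁ = i₁} i₁∈ refl = subst Incl (sym (identityˡ i₁)) i₁∈

  mediate-Incl : {f₁ : Hom A₁ A} {f₂ : Hom A₂ A} {p₁ : Hom P A₁} {p₂ : Hom P A₂}
    (pb : IsPullback C f₁ f₂ p₁ p₂) {q₁ : Hom X A₁} {q₂ : Hom X A₂} (c : q₁ ； f₁ ≡ q₂ ； f₂) →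
    Incl p₁ → Incl q₁ → Incl (mediate pb q₁ q₂ c)
  mediate-Incl pb c p₁∈ q₁∈ = Incl-cancelʳ p₁∈ q₁∈ (mediate-₁ pb _ _ c)

  diagonal-fill : {σ : Hom X Y} {u : Hom Y B} {v : Hom X A} {j : Hom A B} →
    Surj σ → Incl j → σ ； u ≡ v ； j → Σ[ g ∈ Hom Y A ] u ≡ g ； j × σ ； g ≡ v
  diagonal-fill {σ = σ} {u} {v} {j} σ∈ j∈ σu≡vj =
    fill (e (factor u)) (i (factor u)) (eq (factor u)) (eq (factor v))
      (factor-unique (σ ； u) Fᵤ (retarget (postcompose-Incl (factor v) j∈) (sym σu≡vj)))
    where
      Fᵤ : Factorisation C 𝓘 𝓔 (σ ； u)
      Fᵤ = record { e = σ ； e (factor u) ; i = i (factor u)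
                  ; e-surj = BroadSubcategory.Arr-； 𝓔 σ∈ (e-surj (factor u))
                  ; i-incl = i-incl (factor u)
                  ; eq = trans (cong (σ ；_) (eq (factor u))) (sym (assoc _ _ _)) }
      fill : ∀ {M N} (eᵤ : Hom _ M) (iᵤ : Hom M _) {eᵥ : Hom _ N} {iᵥ : Hom N _} →
        u ≡ eᵤ ； iᵤ → v ≡ eᵥ ； iᵥ →
        _≡_ {A = Factored _ _} (M , σ ； eᵤ , iᵤ) (N , eᵥ , iᵥ ； j) →
        Σ[ g ∈ Hom _ _ ] u ≡ g ； j × σ ； g ≡ v
      fill eᵤ _ {iᵥ = iᵥ} u≡ v≡ refl =
        eᵤ ； iᵥ , trans u≡ (sym (assoc _ _ _)) , trans (sym (assoc _ _ _)) (sym v≡)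

  inclusive-pullback : {f : Hom A B} {j : Hom B' B} → Incl j → Pullback C f j →
                       InclusivePullback C IS f j
  inclusive-pullback {f = f} {j} j∈ pb = record
    { A' = mid F ; j = i F ; j-incl = i-incl F ; f' = g
    ; isPB = pullback-retract (e F) m isPB (sym (eq F)) eg≡p₂ m；e≡id }
    where
      open Pullback pb using (p₁; p₂; isPB)
      F = factor p₁
      fill = diagonal-fill (e-surj F) j∈ (begin
        e F ； (i F ； f)   ≡⟨ sym (assoc _ _ _) ⟩
        (e F ； i F) ； f   ≡⟨ cong (_； f) (sym (eq F)) ⟩
        p₁ ； f             ≡⟨ commute isPB ⟩
        p₂ ； j             ∎)
      g = proj₁ fill
      eg≡p₂ = proj₂ (proj₂ fill)
      m = mediate isPB (i F) g (proj₁ (proj₂ fill))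
      m；e≡id : m ； e F ≡ id
      m；e≡id = incl-monic (i-incl F) (begin
        (m ； e F) ； i F  ≡⟨ assoc _ _ _ ⟩
        m ； (e F ； i F)  ≡⟨ cong (m ；_) (sym (eq F)) ⟩
        m ； p₁            ≡⟨ mediate-₁ isPB _ _ _ ⟩
        i F                ≡⟨ sym (identityˡ _) ⟩
        id ； i F          ∎)

  inclusive-pullback-unique : {f : Hom A B} {j : Hom B' B}
    {j₁ : Hom A₁ A} {f₁ : Hom A₁ B'} {j₂ : Hom A₂ A} {f₂ : Hom A₂ B'} →
    IsPullback C f j j₁ f₁ → IsPullback C f j j₂ f₂ → Incl j₁ → Incl j₂ →
    _≡_ {A = Span A B'} (A₁ , j₁ , f₁) (A₂ , j₂ , f₂)
  inclusive-pullback-unique pb₁ pb₂ j₁∈ j₂∈ =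
    identify (mediate-₁ pb₂ _ _ (commute pb₁)) (mediate-₂ pb₂ _ _ (commute pb₁))
      (𝓘-antisym _ _ (mediate-Incl pb₂ (commute pb₁) j₂∈ j₁∈)
                     (mediate-Incl pb₁ (commute pb₂) j₁∈ j₂∈))
      (mediate-Incl pb₂ (commute pb₁) j₂∈ j₁∈)
    where
      identify : ∀ {A₁ A₂} {j₁ : Hom A₁ _} {f₁ : Hom A₁ _} {j₂ : Hom A₂ _} {f₂ : Hom A₂ _}
        {m : Hom A₁ A₂} → m ； j₂ ≡ j₁ → m ； f₂ ≡ f₁ → A₁ ≡ A₂ → Incl m →
        _≡_ {A = Span _ _} (A₁ , j₁ , f₁) (A₂ , j₂ , f₂)
      identify {j₂ = j₂} {f₂ = f₂} mj₂ mf₂ refl m∈ =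
        cong₂ (λ x y → (_ , x , y))
          (trans (sym mj₂) (trans (cong (_； j₂) (Incl-endo⇒id m∈)) (identityˡ j₂)))
          (trans (sym mf₂) (trans (cong (_； f₂) (Incl-endo⇒id m∈)) (identityˡ f₂)))

module PartialMorphisms {o ℓ r s : Level} {C : Category o ℓ} (IS : InclusionSystem C r s)
                        (ipb : InclusivePullbackChoice C IS) where
  open Category C
  open InclusionSystem IS
  open BroadSubcategory 𝓘 using () renaming (Arr-id to Incl-id; Arr-； to Incl-；; Arr-prop to Incl-prop)
  open IsPullback
  open InclusivePullback
  open PMor
  open PullbackProperties C
  open InclusionSystemProperties IS

  private variable
    D Σ₁ Σ₂ Σ₃ Σ₄ : Obj

  _∘ₚ_ : PMor C IS Σ₁ Σ₂ → PMor C IS Σ₂ Σ₃ → PMor C IS Σ₁ Σ₃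
  _∘ₚ_ = pcomp C IS ipb

  pmor-≡ : {i i' : Hom D Σ₁} {p : Incl i} {p' : Incl i'} {a a' : Hom D Σ₂} →
           i ≡ i' → a ≡ a' → _≡_ {A = PMor C IS Σ₁ Σ₂} (pmor D i p a) (pmor D i' p' a')
  pmor-≡ {p = p} {p'} refl refl = cong (λ q → pmor _ _ q _) (Incl-prop p p')

  pcomp-via : (φ : PMor C IS Σ₁ Σ₂) (ψ : PMor C IS Σ₂ Σ₃) {j : Hom D (dom φ)} {f' : Hom D (dom ψ)} →
    IsPullback C (φ⁰ φ) (incl ψ) j f' → (j∈ : Incl j) →
    φ ∘ₚ ψ ≡ pmor D (j ； incl φ) (Incl-； j∈ (incl-inc φ)) (f' ； φ⁰ ψ)
  pcomp-via φ ψ pb j∈ =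
    compose (inclusive-pullback-unique (isPB q) pb (j-incl q) j∈) (j-incl q) j∈
    where
      q = ipb (φ⁰ φ) (incl ψ) (incl-inc ψ)
      compose : ∀ {D₁ D₂} {j₁ : Hom D₁ (dom φ)} {f₁} {j₂ : Hom D₂ (dom φ)} {f₂} →
        _≡_ {A = Span (dom φ) (dom ψ)} (D₁ , j₁ , f₁) (D₂ , j₂ , f₂) → (j₁∈ : Incl j₁) (j₂∈ : Incl j₂) →
        pmor D₁ (j₁ ； incl φ) (Incl-； j₁∈ (incl-inc φ)) (f₁ ； φ⁰ ψ)
          ≡ pmor D₂ (j₂ ； incl φ) (Incl-； j₂∈ (incl-inc φ)) (f₂ ； φ⁰ ψ)
      compose refl _ _ = pmor-≡ refl refl

  identityˡₚ : (φ : PMor C IS Σ₁ Σ₂) → [ C ] IS id ∘ₚ φ ≡ φ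
  identityˡₚ φ = trans (pcomp-via ([ C ] IS id) φ (pullback-of-id (incl φ)) (incl-inc φ))
                       (pmor-≡ (identityʳ (incl φ)) (identityˡ (φ⁰ φ)))

  identityʳₚ : (φ : PMor C IS Σ₁ Σ₂) → φ ∘ₚ [ C ] IS id ≡ φ
  identityʳₚ φ = trans (pcomp-via φ ([ C ] IS id) (pullback-along-id (φ⁰ φ)) Incl-id)
                       (pmor-≡ (identityˡ (incl φ)) (identityʳ (φ⁰ φ)))

  -- φ ∘ₚ (ψ ∘ₚ χ) is computed from the pasting of the two pullbacks defining (φ ∘ₚ ψ) ∘ₚ χ.
  assocₚ : (φ : PMor C IS Σ₁ Σ₂) (ψ : PMor C IS Σ₂ Σ₃) (χ : PMor C IS Σ₃ Σ₄) →
           (φ ∘ₚ ψ) ∘ₚ χ ≡ φ ∘ₚ (ψ ∘ₚ χ)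
  assocₚ φ ψ χ = sym (trans
    (pcomp-via φ (ψ ∘ₚ χ) (pullback-paste (isPB φψ) (proj₁ (proj₂ left-square)))
               (Incl-； (j-incl φψ-χ) (j-incl φψ)))
    (pmor-≡ (assoc _ _ _) (trans (sym (assoc _ _ _)) (cong (_； φ⁰ χ) (proj₂ (proj₂ left-square))))))
    where
      φψ = ipb (φ⁰ φ) (incl ψ) (incl-inc ψ)
      φψ-χ = ipb (f' φψ ； φ⁰ ψ) (incl χ) (incl-inc χ)
      ψχ = ipb (φ⁰ ψ) (incl χ) (incl-inc χ)
      left-square = pullback-cancelʳ (isPB ψχ) (isPB φψ-χ)

  ≤ₚ-antisym : {φ θ : PMor C IS Σ₁ Σ₂} → _≤ₚ_ C IS φ θ → _≤ₚ_ C IS θ φ → φ ≡ θ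
  ≤ₚ-antisym (k , k∈ , φ≡) (k' , k'∈ , _) = collapse k∈ φ≡ (𝓘-antisym k k' k∈ k'∈)
    where
      collapse : ∀ {D D'} {i : Hom D Σ₁} {i' : Hom D' Σ₁} {p : Incl i} {p' : Incl i'}
        {a : Hom D Σ₂} {a' : Hom D' Σ₂} {k : Hom D D'} → Incl k → a ≡ k ； a' → D ≡ D' →
        _≡_ {A = PMor C IS Σ₁ Σ₂} (pmor D i p a) (pmor D' i' p' a')
      collapse {p = p} {p'} {a' = a'} k∈ a≡ refl = pmor-≡ (𝓘-thin _ _ p p')
        (trans a≡ (trans (cong (_； a') (Incl-endo⇒id k∈)) (identityˡ a')))

  ≤ₚ-isPartialOrder : IsPartialOrder _≡_ (_≤ₚ_ C IS {Σ₁} {Σ₂})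
  ≤ₚ-isPartialOrder = record
    { isPreorder = record
      { isEquivalence = isEquivalence
      ; reflexive = λ { {φ} refl → id , Incl-id , sym (identityˡ (φ⁰ φ)) }
      ; trans = λ (k , k∈ , φ≡) (k' , k'∈ , θ≡) →
          k ； k' , Incl-； k∈ k'∈ , trans φ≡ (trans (cong (k ；_) θ≡) (sym (assoc _ _ _)))
      }
    ; antisym = ≤ₚ-antisym
    }

  ∘ₚ-monoˡ : {φ φ' : PMor C IS Σ₁ Σ₂} (ψ : PMor C IS Σ₂ Σ₃) →
             _≤ₚ_ C IS φ φ' → _≤ₚ_ C IS (φ ∘ₚ ψ) (φ' ∘ₚ ψ)
  ∘ₚ-monoˡ {φ = φ} {φ'} ψ (k , k∈ , φ≡) =
    mediate (isPB q') _ _ c ,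
    mediate-Incl (isPB q') c (j-incl q') (Incl-； (j-incl q) k∈) ,
    trans (cong (_； φ⁰ ψ) (sym (mediate-₂ (isPB q') _ _ c))) (assoc _ _ _)
    where
      q = ipb (φ⁰ φ) (incl ψ) (incl-inc ψ)
      q' = ipb (φ⁰ φ') (incl ψ) (incl-inc ψ)
      c : (j q ； k) ； φ⁰ φ' ≡ f' q ； incl ψ
      c = trans (assoc _ _ _) (trans (cong (j q ；_) (sym φ≡)) (commute (isPB q)))

  ∘ₚ-monoʳ : (φ : PMor C IS Σ₁ Σ₂) {ψ ψ' : PMor C IS Σ₂ Σ₃} →
             _≤ₚ_ C IS ψ ψ' → _≤ₚ_ C IS (φ ∘ₚ ψ) (φ ∘ₚ ψ')
  ∘ₚ-monoʳ φ {ψ} {ψ'} (k , k∈ , ψ≡) =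
    mediate (isPB q') _ _ c ,
    mediate-Incl (isPB q') c (j-incl q') (j-incl q) ,
    trans (cong (f' q ；_) ψ≡) (trans (sym (assoc _ _ _))
      (trans (cong (_； φ⁰ ψ') (sym (mediate-₂ (isPB q') _ _ c))) (assoc _ _ _)))
    where
      q = ipb (φ⁰ φ) (incl ψ) (incl-inc ψ)
      q' = ipb (φ⁰ φ) (incl ψ') (incl-inc ψ')
      c : j q ； φ⁰ φ ≡ (f' q ； k) ； incl ψ'
      c = trans (commute (isPB q))
            (trans (cong (f' q ；_) (𝓘-thin _ _ (incl-inc ψ) (Incl-； k∈ (incl-inc ψ'))))
              (sym (assoc _ _ _)))

  pSign-is3/2Category : Is3/2Category Obj (PMor C IS) (_≤ₚ_ C IS) (λ {A} → [ C ] IS (id {A})) _∘ₚ_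
  pSign-is3/2Category = record
    { identityˡ = identityˡₚ ; identityʳ = identityʳₚ ; assoc = assocₚ
    ; isPartialOrder = ≤ₚ-isPartialOrder
    ; ；-monoˡ = λ {_} {_} {_} {φ} {φ'} → ∘ₚ-monoˡ {φ = φ} {φ'} ; ；-monoʳ = ∘ₚ-monoʳ }

mainTheorem1 : ∀ {o ℓ r s : Level} (Sign : Category o ℓ) (IS : InclusionSystem Sign r s) →
    HasSemiInclusivePullbacks Sign IS →
      InclusivePullbackChoice Sign IS
      × ((ipb : InclusivePullbackChoice Sign IS) →
          Is3/2Category (Category.Obj Sign) (PMor Sign IS) (_≤ₚ_ Sign IS)
            (λ {A} → [_] Sign IS (Category.id Sign {A})) (pcomp Sign IS ipb))
mainTheorem1 Sign IS pullbacks =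
  (λ f i i∈ → inclusive-pullback i∈ (pullbacks f i (inj₂ i∈))) ,
  PartialMorphisms.pSign-is3/2Category IS
  where open InclusionSystemProperties IS using (inclusive-pullback)
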